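{- Let $X$ be a finite set and let $\mathcal{D}\subseteq\mathcal{R}(X)$ have the generalized single-crossing property. Let $Q,R\in\mathcal{D}$ be adjacent in $\Gamma_{\mathcal{D}}$, and let $P\in[Q,R]$ with $P\ne Q$ and $P\ne R$. Then $\mathcal{D}\cup\{P\}$ also has the generalized single-crossing property; in particular, $\mathcal{D}$ is not a maximal Condorcet domain.
   Context: $\mathcal{R}(X)$ is the set of strict linear orders on $X$. For $R,R'\in\mathcal{R}(X)$ let $[R,R']=\{Q\in\mathcal{R}(X): Q\supseteq R\cap R'\}$. $\Gamma_{\mathcal{D}}$ is the graph on $\mathcal{D}$ with distinct $R,R'$ adjacent iff $[R,R']\cap\mathcal{D}=\{R,R'\}$. $\mathcal{D}$ is single-crossing with respect to a tree $T=(V,E)$ if $|\mathcal{D}|=|V|$ and $\mathcal{D}=\{R_v:v\in V\}$ (bijectively) with $R_u\in[R_v,R_{v'}]$ whenever $u$ lies on the $T$-path between $v$ and $v'$; generalized single-crossing means single-crossing with respect to some tree. A Condorcet domain is a domain on which the majority relation of every profile (tuple of orders from the domain; $x$ above $y$ iff more than half of the voters rank $x$ above $y$) is acyclic; it is maximal if no Condorcet domain on $X$ properly contains it. -}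

module Defs where

open import Data.Nat using (ℕ; zero; suc; _+_; _*_; _<_; _≤_)
open import Data.Bool using (Bool; true; false; T)
open import Data.Fin using (Fin; zero; suc)
open import Data.Vec using (Vec; lookup)
open import Data.List using (List; []; _∷_; length)
open import Data.List.Membership.Propositional using (_∈_)
open import Data.List.Relation.Unary.Unique.Propositional using (Unique)
open import Data.Product using (Σ; ∃; _×_; _,_)
open import Data.Sum using (_⊎_)
open import Data.Empty using (⊥)
open import Relation.Nullary using (¬_)
open import Relation.Binary.PropositionalEquality using (_≡_; _≢_)
open import Relation.Binary.Construct.Closure.Transitive using (TransClosure)
open import Function.Definitions using (Injective)

-- Binary relations on X = Fin n, encoded by their adjacency matrix.
-- rel R x y  means  "x R y"  (x is ranked above y).

Ord : ℕ → Set
Ord n = Vec (Vec Bool n) n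

rel : ∀ {n} → Ord n → Fin n → Fin n → Set
rel R x y = T (lookup (lookup R x) y)

record IsLinOrder {n : ℕ} (R : Ord n) : Set where
  field
    irrefl : ∀ x → ¬ rel R x x
    trans  : ∀ x y z → rel R x y → rel R y z → rel R x z
    total  : ∀ x y → x ≢ y → rel R x y ⊎ rel R y x

Domain : ℕ → Set₁
Domain n = Ord n → Set

IsDomain : ∀ {n} → Domain n → Set
IsDomain {n} D = ∀ (R : Ord n) → D R → IsLinOrder R

_∈[_,_] : ∀ {n} → Ord n → Ord n → Ord n → Set
_∈[_,_] {n} Q R R' =
  IsLinOrder Q × (∀ (x y : Fin n) → rel R x y → rel R' x y → rel Q x y)

AdjΓ : ∀ {n} → Domain n → Ord n → Ord n → Set
AdjΓ {n} D R R' =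
  D R × D R' × R ≢ R' ×
  (∀ (S : Ord n) → D S → S ∈[ R , R' ] → S ≡ R ⊎ S ≡ R')

_∪｛_｝ : ∀ {n} → Domain n → Ord n → Domain n
(D ∪｛ P ｝) S = D S ⊎ S ≡ P

Graph : ℕ → Set
Graph m = Fin m → Fin m → Bool

data Walk {m : ℕ} (G : Graph m) : Fin m → Fin m → List (Fin m) → Set where
  here : ∀ v → Walk G v v (v ∷ [])
  step : ∀ {u v w ps} → T (G u v) → Walk G v w ps → Walk G u w (u ∷ ps)

IsPath : ∀ {m} → Graph m → Fin m → Fin m → List (Fin m) → Set
IsPath G u w ps = Walk G u w ps × Unique ps

record IsTree {m : ℕ} (G : Graph m) : Set where
  field
    symmetric   : ∀ u v → T (G u v) → T (G v u)
    irreflexive : ∀ u → ¬ T (G u u)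
    connected   : ∀ u v → ∃ λ ps → Walk G u v ps
    acyclic     : ∀ u v ps → IsPath G u v ps → 3 ≤ length ps → ¬ T (G v u)

OnPath : ∀ {m} → Graph m → Fin m → Fin m → Fin m → Set
OnPath G u v v' = ∃ λ ps → IsPath G v v' ps × u ∈ ps

SingleCrossingWrt : ∀ {n} → Domain n → (m : ℕ) → Graph m → Set
SingleCrossingWrt {n} D m G =
  Σ (Fin m → Ord n) λ f →
    (∀ v → D (f v)) ×
    Injective _≡_ _≡_ f ×
    (∀ (R : Ord n) → D R → ∃ λ v → f v ≡ R) ×
    (∀ u v v' → OnPath G u v v' → f u ∈[ f v , f v' ])

GeneralizedSingleCrossing : ∀ {n} → Domain n → Set
GeneralizedSingleCrossing D =
  ∃ λ m → Σ (Graph m) λ G → IsTree G × SingleCrossingWrt D m G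

count : ∀ {k} → (Fin k → Bool) → ℕ
count {zero} p = 0
count {suc k} p with p zero
... | true  = suc (count (λ i → p (suc i)))
... | false = count (λ i → p (suc i))

Majority : ∀ {n k} → (Fin k → Ord n) → Fin n → Fin n → Set
Majority {n} {k} prof x y = k < 2 * count (λ i → lookup (lookup (prof i) x) y)

Acyclic : ∀ {n} → (Fin n → Fin n → Set) → Set
Acyclic {n} _≻_ = ∀ (x : Fin n) → ¬ TransClosure _≻_ x x

IsCondorcet : ∀ {n} → Domain n → Set
IsCondorcet {n} D =
  IsDomain D ×
  (∀ (k : ℕ) (prof : Fin k → Ord n) → (∀ i → D (prof i)) → Acyclic (Majority prof))

IsMaximalCondorcet : ∀ {n} → Domain n → Set₁
IsMaximalCondorcet {n} D =
  IsCondorcet D ×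
  (∀ (D' : Domain n) → IsCondorcet D' → (∀ R → D R → D' R) →
     ¬ (∃ λ R → D' R × ¬ D R))

module Submission where

-- Let D be single-crossing with respect to the tree G via f, with Q = f q and
-- R = f r.  Every vertex on the G-path from q to r carries an order of D in
-- [Q, R], hence equals Q or R; so q and r are adjacent in G.  Subdividing the
-- edge q–r by a new vertex labelled P yields a tree, and a path through the
-- new vertex is, read in G, a path through q and r; since [Q, R] ⊆ [A, B]
-- whenever Q, R ∈ [A, B], the labelling stays single-crossing.
--
-- Non-maximality: if D is Condorcet, so is D ∪ {P}.  A majority cycle of a
-- profile over D ∪ {P} that has no edge where P departs from Q survives when
-- the P-voters switch to Q (which contradicts D being Condorcet), and likewise
-- for R.  Otherwise the cycle contains an edge where P departs from Q and one
-- where P departs from R; a tree-path argument shows that two voters agreeing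
-- with P on these edges agree only where P does, and since two majorities
-- share a voter, every majority edge lies in P: a cycle in the order P.

open import Defs
open import Data.Nat using (ℕ; zero; suc; _+_; _*_; _<_; _≤_; s≤s; z≤n; _≤?_)
open import Data.Nat.Properties
  using (≤-trans; +-mono-≤; *-monoʳ-≤; *-distribˡ-+; *-cancelˡ-≤; +-suc; +-identityʳ; n≤1+n; <-irrefl; module ≤-Reasoning)
open import Data.Bool using (Bool; true; false; T)
open import Data.Fin using (Fin; zero; suc) renaming (_≟_ to _≟F_)
open import Data.Fin.Properties using (any?; suc-injective)
open import Data.List using (List; []; _∷_; _++_; length; reverse)
open import Data.List.Properties using (length-++; length-reverse; unfold-reverse)
open import Data.List.Membership.Propositional using (_∈_; _∉_)
open import Data.List.Membership.Propositional.Properties using (∈-++⁺ˡ; ∈-++⁺ʳ)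
open import Data.List.Relation.Unary.Any using (here; there)
open import Data.List.Relation.Unary.Any.Properties using (reverse⁺)
open import Data.List.Relation.Unary.All.Properties using (¬Any⇒All¬)
open import Data.List.Relation.Unary.AllPairs using (_∷_)
import Data.List.Relation.Unary.AllPairs as AllPairs
open import Data.List.Relation.Unary.Unique.Propositional using (Unique)
open import Data.List.Relation.Unary.Unique.Propositional.Properties using (++⁺; Unique[x∷xs]⇒x∉xs)
open import Data.List.Relation.Binary.Disjoint.Propositional using (Disjoint)
open import Data.List.Relation.Binary.Subset.Propositional using (_⊆_)
open import Data.List.Relation.Binary.Permutation.Propositional using (↭⇒↭ₛ; ↭-sym)
open import Data.List.Relation.Binary.Permutation.Propositional.Properties using (↭-reverse)
import Data.List.Relation.Binary.Permutation.Setoid.Properties as PermutationSetoid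
import Data.List.Membership.DecPropositional as DecMembership
open import Data.Product using (∃; _×_; _,_; proj₁; proj₂)
open import Data.Sum using (_⊎_; inj₁; inj₂; [_,_]′)
open import Data.Empty using (⊥; ⊥-elim)
open import Data.Unit using (tt)
open import Function using (_∘_; id; const)
open import Function.Definitions using (Injective)
open import Relation.Nullary using (¬_; Dec; yes; no)
open import Relation.Nullary.Decidable using (⌊_⌋; T?; ¬?; _×-dec_; _⊎-dec_; toWitness; fromWitness)
open import Relation.Binary.PropositionalEquality
  using (_≡_; _≢_; refl; sym; trans; cong; subst; setoid)
open import Relation.Binary.Construct.Closure.Transitive using (TransClosure; [_]; _∷_; transitive⁻)

unique-∷ : ∀ {A : Set} {x : A} {xs} → x ∉ xs → Unique xs → Unique (x ∷ xs)
unique-∷ {xs = xs} x∉xs u = ¬Any⇒All¬ xs x∉xs ∷ u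

unique-tail : ∀ {A : Set} {x : A} {xs} → Unique (x ∷ xs) → Unique xs
unique-tail (_ ∷ u) = u

unique-reverse : ∀ {A : Set} {xs : List A} → Unique xs → Unique (reverse xs)
unique-reverse {A} {xs} =
  PermutationSetoid.Unique-resp-↭ (setoid A) (↭⇒↭ₛ (↭-sym (↭-reverse xs)))

-- Walks and paths in an arbitrary graph

module Walks {m : ℕ} (G : Graph m) where

  walk-head : ∀ {u w ps} → Walk G u w ps → u ∈ ps
  walk-head (here _)   = here refl
  walk-head (step _ _) = here refl

  walk-last : ∀ {u w ps} → Walk G u w ps → w ∈ ps
  walk-last (here _)   = here refl
  walk-last (step _ w) = there (walk-last w)

  walk-nonempty : ∀ {u w ps} → Walk G u w ps → 1 ≤ length ps
  walk-nonempty (here _)   = s≤s z≤n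
  walk-nonempty (step _ _) = s≤s z≤n

  walk-long : ∀ {u w ps} → Walk G u w ps → u ≢ w → 2 ≤ length ps
  walk-long (here _)   u≢w = ⊥-elim (u≢w refl)
  walk-long (step _ w) _   = s≤s (walk-nonempty w)

  path-ends-distinct : ∀ {u w ps} → Walk G u w ps → Unique ps → 2 ≤ length ps → u ≢ w
  path-ends-distinct (here _)   _  (s≤s ())
  path-ends-distinct (step _ w) uq _ refl = Unique[x∷xs]⇒x∉xs uq (walk-last w)

  walk-join : ∀ {u v x w ps qs} → Walk G u v ps → T (G v x) → Walk G x w qs → Walk G u w (ps ++ qs)
  walk-join (here _)   e w′ = step e w′
  walk-join (step d w) e w′ = step d (walk-join w e w′)

  walk-prefix : ∀ {v w z ps} → Walk G v w ps → z ∈ ps →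
    ∃ λ pre → Walk G v z pre × pre ⊆ ps × (Unique ps → Unique pre)
  walk-prefix (here v) (here refl) = v ∷ [] , here v , id , id
  walk-prefix (step {u} e w) (here refl) =
    u ∷ [] , here u , (λ { (here eq) → here eq }) , (λ _ → unique-∷ (λ ()) (AllPairs.[]))
  walk-prefix (step {u} e w) (there z∈) with walk-prefix w z∈
  ... | pre , wpre , pre⊆ , upre =
    u ∷ pre , step e wpre ,
    (λ { (here eq) → here eq ; (there y∈) → there (pre⊆ y∈) }) ,
    (λ uq → unique-∷ (Unique[x∷xs]⇒x∉xs uq ∘ pre⊆) (upre (unique-tail uq)))

  walk-suffix : ∀ {v w z ps} → Walk G v w ps → z ∈ ps →
    ∃ λ suf → Walk G z w suf × (Unique ps → Unique suf)
  walk-suffix (here v)   (here refl) = v ∷ [] , here v , id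
  walk-suffix (step e w) (here refl) = _ , step e w , id
  walk-suffix (step e w) (there z∈) with walk-suffix w z∈
  ... | suf , wsuf , usuf = suf , wsuf , usuf ∘ unique-tail

  toPath : ∀ {u w ps} → Walk G u w ps → ∃ λ qs → IsPath G u w qs
  toPath (here v) = v ∷ [] , here v , unique-∷ (λ ()) AllPairs.[]
  toPath (step {u} e w) with toPath w
  ... | qs , wq , uq with DecMembership._∈?_ _≟F_ u qs
  ...   | yes u∈ = let (suf , wsuf , usuf) = walk-suffix wq u∈ in suf , wsuf , usuf uq
  ...   | no u∉  = u ∷ qs , step e wq , unique-∷ u∉ uq

  onPath-loop : ∀ {u v} → OnPath G u v v → u ≡ v
  onPath-loop (_ , (here _ , _) , here u≡v) = u≡v
  onPath-loop (_ , (here _ , _) , there ())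
  onPath-loop (_ , (step e w , uq) , _) =
    ⊥-elim (path-ends-distinct (step e w) uq (s≤s (walk-nonempty w)) refl)

  module Undirected (symmetric : ∀ u v → T (G u v) → T (G v u)) where

    walk-reverse : ∀ {u w ps} → Walk G u w ps → Walk G w u (reverse ps)
    walk-reverse (here v) = here v
    walk-reverse (step {u} {ps = ps} e w) rewrite unfold-reverse u ps =
      walk-join (walk-reverse w) (symmetric _ _ e) (here u)

    path-reverse : ∀ {u w ps} → IsPath G u w ps → IsPath G w u (reverse ps)
    path-reverse (w , uq) = walk-reverse w , unique-reverse uq

    onPath-reverse : ∀ {u v w} → OnPath G u v w → OnPath G u w v
    onPath-reverse (ps , path , u∈) = reverse ps , path-reverse path , reverse⁺ u∈

length-++-≥3 : ∀ {A : Set} (xs ys : List A) → 2 ≤ length xs → 1 ≤ length ys → 3 ≤ length (xs ++ ys)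
length-++-≥3 xs ys 2≤xs 1≤ys = subst (3 ≤_) (sym (length-++ xs)) (+-mono-≤ 2≤xs 1≤ys)

-- Paths through an edge of a tree

module TreeEdge {m : ℕ} {G : Graph m} (tree : IsTree G) {q r : Fin m} (r–q : T (G r q)) where
  open IsTree tree
  open Walks G

  -- A path ending at r avoiding q and a path starting at q avoiding r are
  -- disjoint: a common vertex would close a cycle through the edge r–q.
  sides-disjoint : ∀ {a b ps qs} → Walk G a r ps → Unique ps → q ∉ ps →
                   Walk G q b qs → Unique qs → r ∉ qs → Disjoint ps qs
  sides-disjoint (here _) _ _ _ _ r∉qs (here refl , r∈qs) = r∉qs r∈qs
  sides-disjoint (step e w) uq q∉ wq uqs r∉ (there z∈ , z∈qs) =
    sides-disjoint w (unique-tail uq) (q∉ ∘ there) wq uqs r∉ (z∈ , z∈qs)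
  sides-disjoint {ps = a ∷ tl} (step e w) uq q∉ wq uqs r∉ (here refl , a∈qs)
    with walk-prefix wq a∈qs
  ... | pre , wpre , pre⊆qs , upre =
    acyclic q r (pre ++ tl) cycle
      (length-++-≥3 pre tl (walk-long wpre (λ q≡a → q∉ (here q≡a))) (walk-nonempty w)) r–q
    where
      tail-disjoint : Disjoint pre tl
      tail-disjoint (y∈pre , y∈tl) =
        sides-disjoint w (unique-tail uq) (q∉ ∘ there) wq uqs r∉ (y∈tl , pre⊆qs y∈pre)
      cycle : IsPath G q r (pre ++ tl)
      cycle = walk-join wpre e w , ++⁺ (upre uqs) (unique-tail uq) tail-disjoint

  join-through-edge : ∀ {a b ps qs} → IsPath G a r ps → q ∉ ps → IsPath G q b qs → r ∉ qs →
                      IsPath G a b (ps ++ qs)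
  join-through-edge (w , uq) q∉ (w′ , uq′) r∉ =
    walk-join w r–q w′ , ++⁺ uq uq′ (sides-disjoint w uq q∉ w′ uq′ r∉)

-- Subdividing an edge of a tree
--
-- The edge q–r of the tree G is replaced by q–new–r; the new vertex is zero
-- and an old vertex v becomes suc v.  The result is again a tree, and paths
-- in it correspond to paths in G.

module Subdivision {m : ℕ} {G : Graph m} (tree : IsTree G) {q r : Fin m} (q–r : T (G q r)) where
  open IsTree tree
  open Walks G

  Ends : Fin m → Set
  Ends v = v ≡ q ⊎ v ≡ r

  IsQR : Fin m → Fin m → Set
  IsQR u v = (u ≡ q × v ≡ r) ⊎ (u ≡ r × v ≡ q)

  ends? : ∀ v → Dec (Ends v)
  ends? v = (v ≟F q) ⊎-dec (v ≟F r)

  isQR? : ∀ u v → Dec (IsQR u v)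
  isQR? u v = ((u ≟F q) ×-dec (v ≟F r)) ⊎-dec ((u ≟F r) ×-dec (v ≟F q))

  old-edge? : ∀ u v → Dec (T (G u v) × ¬ IsQR u v)
  old-edge? u v = T? (G u v) ×-dec ¬? (isQR? u v)

  G′ : Graph (suc m)
  G′ zero    zero    = false
  G′ zero    (suc v) = ⌊ ends? v ⌋
  G′ (suc u) zero    = ⌊ ends? u ⌋
  G′ (suc u) (suc v) = ⌊ old-edge? u v ⌋

  module W′ = Walks G′

  old-edge : ∀ {u v} → T (G′ (suc u) (suc v)) → T (G u v) × ¬ IsQR u v
  old-edge {u} {v} = toWitness {a? = old-edge? u v}

  old-edge⁺ : ∀ {u v} → T (G u v) → ¬ IsQR u v → T (G′ (suc u) (suc v))
  old-edge⁺ {u} {v} e ¬qr = fromWitness {a? = old-edge? u v} (e , ¬qr)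

  new-edge : ∀ {v} → T (G′ zero (suc v)) → Ends v
  new-edge {v} = toWitness {a? = ends? v}

  new-edge⁺ : ∀ {v} → Ends v → T (G′ zero (suc v))
  new-edge⁺ {v} = fromWitness {a? = ends? v}

  q≢r : q ≢ r
  q≢r refl = irreflexive q q–r

  ends-QR : ∀ {a b} → Ends a → Ends b → a ≢ b → IsQR a b
  ends-QR (inj₁ refl) (inj₁ refl) a≢b = ⊥-elim (a≢b refl)
  ends-QR (inj₁ a≡q)  (inj₂ b≡r)  _   = inj₁ (a≡q , b≡r)
  ends-QR (inj₂ a≡r)  (inj₁ b≡q)  _   = inj₂ (a≡r , b≡q)
  ends-QR (inj₂ refl) (inj₂ refl) a≢b = ⊥-elim (a≢b refl)

  QR-ends : ∀ {a b} → IsQR a b → Ends a × Ends b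
  QR-ends (inj₁ (a≡q , b≡r)) = inj₁ a≡q , inj₂ b≡r
  QR-ends (inj₂ (a≡r , b≡q)) = inj₂ a≡r , inj₁ b≡q

  QR-sym : ∀ {a b} → IsQR a b → IsQR b a
  QR-sym (inj₁ (a≡q , b≡r)) = inj₂ (b≡r , a≡q)
  QR-sym (inj₂ (a≡r , b≡q)) = inj₁ (b≡q , a≡r)

  QR-distinct : ∀ {a b} → IsQR a b → a ≢ b
  QR-distinct (inj₁ (refl , refl)) = q≢r
  QR-distinct (inj₂ (refl , refl)) = q≢r ∘ sym

  QR-edge : ∀ {a b} → IsQR a b → T (G a b)
  QR-edge (inj₁ (refl , refl)) = q–r
  QR-edge (inj₂ (refl , refl)) = symmetric q r q–r

  symmetric′ : ∀ u v → T (G′ u v) → T (G′ v u)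
  symmetric′ zero    zero    e = e
  symmetric′ zero    (suc v) e = e
  symmetric′ (suc u) zero    e = e
  symmetric′ (suc u) (suc v) e with old-edge e
  ... | g , ¬qr = old-edge⁺ (symmetric u v g) (¬qr ∘ QR-sym)

  irreflexive′ : ∀ u → ¬ T (G′ u u)
  irreflexive′ zero    ()
  irreflexive′ (suc u) e = irreflexive u (proj₁ (old-edge e))

  open W′.Undirected symmetric′ using (path-reverse; onPath-reverse) public

  lift : ∀ {u w ps} → Walk G u w ps → ∃ λ ps′ → Walk G′ (suc u) (suc w) ps′
  lift (here u) = _ , here (suc u)
  lift (step {u} {v} e w) with isQR? u v
  ... | yes qr = _ , step {v = zero} (new-edge⁺ (proj₁ (QR-ends qr)))
                        (step (new-edge⁺ (proj₂ (QR-ends qr))) (proj₂ (lift w)))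
  ... | no ¬qr = _ , step (old-edge⁺ e ¬qr) (proj₂ (lift w))

  connected′ : ∀ u v → ∃ λ ps → Walk G′ u v ps
  connected′ zero    zero    = _ , here zero
  connected′ zero    (suc v) = _ , step {v = suc q} (new-edge⁺ (inj₁ refl)) (proj₂ (lift (proj₂ (connected q v))))
  connected′ (suc u) zero    = _ , W′.walk-join (proj₂ (lift (proj₂ (connected u q)))) (new-edge⁺ (inj₁ refl)) (here zero)
  connected′ (suc u) (suc v) = lift (proj₂ (connected u v))

  old : List (Fin (suc m)) → List (Fin m)
  old []           = []
  old (zero ∷ xs)  = old xs
  old (suc x ∷ xs) = x ∷ old xs

  old-∈ : ∀ {z} xs → suc z ∈ xs → z ∈ old xs
  old-∈ (zero ∷ xs)  (here ())
  old-∈ (zero ∷ xs)  (there z∈) = old-∈ xs z∈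
  old-∈ (suc x ∷ xs) (here refl) = here refl
  old-∈ (suc x ∷ xs) (there z∈) = there (old-∈ xs z∈)

  ∈-old : ∀ {z} xs → z ∈ old xs → suc z ∈ xs
  ∈-old (zero ∷ xs)  z∈ = there (∈-old xs z∈)
  ∈-old (suc x ∷ xs) (here refl) = here refl
  ∈-old (suc x ∷ xs) (there z∈) = there (∈-old xs z∈)

  old-unique : ∀ xs → Unique xs → Unique (old xs)
  old-unique []           _ = AllPairs.[]
  old-unique (zero ∷ xs)  u = old-unique xs (unique-tail u)
  old-unique (suc x ∷ xs) u =
    unique-∷ (Unique[x∷xs]⇒x∉xs u ∘ ∈-old xs) (old-unique xs (unique-tail u))

  old-length : ∀ xs → zero ∉ xs → length (old xs) ≡ length xs
  old-length []           _  = refl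
  old-length (zero ∷ xs)  0∉ = ⊥-elim (0∉ (here refl))
  old-length (suc x ∷ xs) 0∉ = cong suc (old-length xs (0∉ ∘ there))

  across-new : ∀ {u v} → T (G′ (suc u) zero) → T (G′ zero (suc v)) → u ≢ v → IsQR u v
  across-new {u} {v} e e′ = ends-QR (new-edge {u} e) (new-edge {v} e′)

  around-new-distinct : ∀ {u v w ps} → Walk G′ (suc v) w ps → Unique (suc u ∷ zero ∷ ps) → u ≢ v
  around-new-distinct w uq refl = Unique[x∷xs]⇒x∉xs uq (there (W′.walk-head w))

  old-walk : ∀ {u w ps} → Walk G′ (suc u) (suc w) ps → Unique ps → Walk G u w (old ps)
  old-walk (here _) _ = here _
  old-walk (step {v = suc v} e w) uq = step (proj₁ (old-edge e)) (old-walk w (unique-tail uq))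
  old-walk (step {v = zero} e (step {v = suc v} e′ w)) uq =
    step (QR-edge (across-new e e′ (around-new-distinct w uq)))
         (old-walk w (unique-tail (unique-tail uq)))

  old-path : ∀ {u w ps} → IsPath G′ (suc u) (suc w) ps → IsPath G u w (old ps)
  old-path {ps = ps} (w , uq) = old-walk w uq , old-unique ps uq

  new-on-walk : ∀ {u w ps} → Walk G′ (suc u) (suc w) ps → Unique ps → zero ∈ ps →
                q ∈ old ps × r ∈ old ps
  new-on-walk (here _) _ (here ())
  new-on-walk (here _) _ (there ())
  new-on-walk (step {v = suc v} e w) uq (here ())
  new-on-walk (step {v = suc v} e w) uq (there 0∈) with new-on-walk w (unique-tail uq) 0∈
  ... | q∈ , r∈ = there q∈ , there r∈
  new-on-walk (step {v = zero} e (step {v = suc v} {ps = ps} e′ w)) uq _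
    with across-new e e′ (around-new-distinct w uq)
  ... | inj₁ (refl , refl) = here refl , there (old-∈ ps (W′.walk-head w))
  ... | inj₂ (refl , refl) = there (old-∈ ps (W′.walk-head w)) , here refl

  short-walk : ∀ {u v ps z} → Walk G u v ps → ¬ (3 ≤ length ps) → z ∈ ps → z ≡ u ⊎ z ≡ v
  short-walk (here _) _ (here z≡u) = inj₁ z≡u
  short-walk (step _ (here _)) _ (here z≡u) = inj₁ z≡u
  short-walk (step _ (here _)) _ (there (here z≡v)) = inj₂ z≡v
  short-walk (step _ (step _ w)) short _ = ⊥-elim (short (s≤s (s≤s (walk-nonempty w))))

  acyclic-from-new : ∀ v ps → IsPath G′ zero (suc v) ps → 3 ≤ length ps → ¬ T (G′ (suc v) zero)
  acyclic-from-new v _ (step {v = suc a} e (here _) , _) (s≤s (s≤s ())) _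
  acyclic-from-new v _ (step {v = suc a} e (step e′ (here _)) , uq) _ v–new =
    proj₂ (old-edge e′) (ends-QR (new-edge e) (new-edge v–new) a≢v)
    where
      a≢v : a ≢ v
      a≢v refl = Unique[x∷xs]⇒x∉xs (unique-tail uq) (here refl)
  acyclic-from-new v (zero ∷ ps) (step {v = suc a} e w@(step e′ (step e″ w″)) , uq) _ v–new =
    acyclic a v (old ps) (old-path (w , unique-tail uq))
      (subst (3 ≤_) (sym (old-length ps (Unique[x∷xs]⇒x∉xs uq))) (s≤s (s≤s (W′.walk-nonempty w″))))
      (QR-edge (ends-QR (new-edge v–new) (new-edge e) (a≢v ∘ sym)))
    where
      a≢v : a ≢ v
      a≢v a≡v = W′.path-ends-distinct w (unique-tail uq) (s≤s (s≤s z≤n)) (cong suc a≡v)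

  acyclic′ : ∀ u v ps → IsPath G′ u v ps → 3 ≤ length ps → ¬ T (G′ v u)
  acyclic′ zero    zero    _  _    _  ()
  acyclic′ zero    (suc v) ps path ≥3 = acyclic-from-new v ps path ≥3
  acyclic′ (suc u) zero    ps path ≥3 =
    acyclic-from-new u (reverse ps) (path-reverse path) (subst (3 ≤_) (sym (length-reverse ps)) ≥3)
  acyclic′ (suc u) (suc v) ps (w , uq) ≥3 v–u with 3 ≤? length (old ps)
  ... | yes old≥3 = acyclic u v (old ps) (old-path (w , uq)) old≥3 (proj₁ (old-edge v–u))
  ... | no old<3 with DecMembership._∈?_ _≟F_ zero ps
  ...   | no 0∉  = old<3 (subst (3 ≤_) (sym (old-length ps 0∉)) ≥3)
  ...   | yes 0∈ with new-on-walk w uq 0∈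
  ...     | q∈ , r∈ with short-walk (old-walk w uq) old<3 q∈ | short-walk (old-walk w uq) old<3 r∈
  ...       | inj₁ q≡u | inj₁ r≡u = q≢r (trans q≡u (sym r≡u))
  ...       | inj₂ q≡v | inj₂ r≡v = q≢r (trans q≡v (sym r≡v))
  ...       | inj₁ q≡u | inj₂ r≡v = proj₂ (old-edge v–u) (inj₂ (sym r≡v , sym q≡u))
  ...       | inj₂ q≡v | inj₁ r≡u = proj₂ (old-edge v–u) (inj₁ (sym q≡v , sym r≡u))

  tree′ : IsTree G′
  tree′ = record
    { symmetric = symmetric′ ; irreflexive = irreflexive′
    ; connected = connected′ ; acyclic = acyclic′ }

  -- A path leaving the new vertex through the end a, with b the other end,
  -- becomes a path of G when b is put in front: b cannot occur later, since
  -- that would close a cycle through the new vertex.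
  other-end-path : ∀ {a b w ps} → IsQR b a → Walk G′ (suc a) (suc w) ps → Unique (zero ∷ ps) →
                   IsPath G b w (b ∷ old ps)
  other-end-path {a} {b} {w} {ps} ba wk uq =
    step (QR-edge ba) (old-walk wk (unique-tail uq)) , unique-∷ b∉ (old-unique ps (unique-tail uq))
    where
      b∉ : b ∉ old ps
      b∉ b∈ with W′.walk-prefix wk (∈-old ps b∈)
      ... | pre , wpre , pre⊆ , upre =
        acyclic-from-new b (zero ∷ pre)
          (step (new-edge⁺ (proj₂ (QR-ends ba))) wpre ,
           unique-∷ (Unique[x∷xs]⇒x∉xs uq ∘ pre⊆) (upre (unique-tail uq)))
          (s≤s (W′.walk-long wpre (QR-distinct (QR-sym ba) ∘ suc-injective)))
          (new-edge⁺ (proj₁ (QR-ends ba)))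

  onPath-old : ∀ {u v w} → OnPath G′ (suc u) (suc v) (suc w) → OnPath G u v w
  onPath-old (ps , path , u∈) = old ps , old-path path , old-∈ ps u∈

  onPath-new-inner : ∀ {v w} → OnPath G′ zero (suc v) (suc w) → OnPath G q v w × OnPath G r v w
  onPath-new-inner (ps , path@(w , uq) , 0∈) with new-on-walk w uq 0∈
  ... | q∈ , r∈ = (old ps , old-path path , q∈) , (old ps , old-path path , r∈)

  onPath-new-start : ∀ {u w} → OnPath G′ (suc u) zero (suc w) → OnPath G u q w × OnPath G u r w
  onPath-new-start (zero ∷ ps , (step {v = suc a} e wk , uq) , there u∈) with new-edge e
  ... | inj₁ refl = along , around (inj₂ (refl , refl))
    where
      along : OnPath G _ q _
      along = old ps , old-path (wk , unique-tail uq) , old-∈ ps u∈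
      around : IsQR r q → OnPath G _ r _
      around rq = r ∷ old ps , other-end-path rq wk uq , there (old-∈ ps u∈)
  ... | inj₂ refl = around (inj₁ (refl , refl)) , along
    where
      along : OnPath G _ r _
      along = old ps , old-path (wk , unique-tail uq) , old-∈ ps u∈
      around : IsQR q r → OnPath G _ q _
      around qr = q ∷ old ps , other-end-path qr wk uq , there (old-∈ ps u∈)

-- Linear orders and intervals [A , B]

module _ {n : ℕ} where

  asym : ∀ {O : Ord n} → IsLinOrder O → ∀ {x y} → rel O x y → ¬ rel O y x
  asym lin {x} {y} xy yx = IsLinOrder.irrefl lin x (IsLinOrder.trans lin x y x xy yx)

  compare : ∀ {P O : Ord n} → IsLinOrder P → IsLinOrder O → ∀ {x y} → rel P x y →
            rel O x y ⊎ rel O y x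
  compare linP linO {x} {y} pxy = IsLinOrder.total linO x y (λ { refl → IsLinOrder.irrefl linP x pxy })

  agree-unless-reversed : ∀ {P O : Ord n} → IsLinOrder P → IsLinOrder O → ∀ {x y} →
                          ¬ (rel P x y × rel O y x) → rel P x y → rel O x y
  agree-unless-reversed linP linO reversed pxy with compare linP linO pxy
  ... | inj₁ oxy = oxy
  ... | inj₂ oyx = ⊥-elim (reversed (pxy , oyx))

  rel-≡ : ∀ {O O′ : Ord n} → O ≡ O′ → ∀ {x y} → rel O x y → rel O′ x y
  rel-≡ refl r = r

  interval-sym : ∀ {O A B : Ord n} → O ∈[ A , B ] → O ∈[ B , A ]
  interval-sym (linO , between) = linO , λ x y b a → between x y a b

  interval-flip : ∀ {P A B : Ord n} → IsLinOrder B → P ∈[ A , B ] → ∀ {x y} →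
                  rel P x y → rel A y x → rel B x y
  interval-flip linB (linP , between) {x} {y} pxy ayx with compare linP linB pxy
  ... | inj₁ bxy = bxy
  ... | inj₂ byx = ⊥-elim (asym linP pxy (between y x ayx byx))

  interval-trans : ∀ {P Q R A B : Ord n} → P ∈[ Q , R ] → Q ∈[ A , B ] → R ∈[ A , B ] → P ∈[ A , B ]
  interval-trans (linP , inQR) (_ , QinAB) (_ , RinAB) =
    linP , λ x y axy bxy → inQR x y (QinAB x y axy bxy) (RinAB x y axy bxy)

  interval-merge : ∀ {O P Q R W : Ord n} → IsLinOrder Q → IsLinOrder R → P ∈[ Q , R ] →
                   O ∈[ Q , W ] → O ∈[ R , W ] → O ∈[ P , W ]
  interval-merge {O} {P} {Q} {R} {W} linQ linR P∈ (linO , viaQ) (_ , viaR) = linO , merged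
    where
      merged : ∀ x y → rel P x y → rel W x y → rel O x y
      merged x y pxy wxy with compare (proj₁ P∈) linR pxy
      ... | inj₁ rxy = viaR x y rxy wxy
      ... | inj₂ ryx = viaQ x y (interval-flip {P = P} {A = R} {B = Q} linQ (interval-sym {O = P} {A = Q} {B = R} P∈) pxy ryx) wxy

-- Counting voters and majorities

count-mono : ∀ {k} (p p′ : Fin k → Bool) → (∀ i → T (p i) → T (p′ i)) → count p ≤ count p′
count-mono {zero}  p p′ h = z≤n
count-mono {suc k} p p′ h with p zero in e | p′ zero in e′
... | true  | true  = s≤s (count-mono _ _ (h ∘ suc))
... | true  | false = ⊥-elim (subst T e′ (h zero (subst T (sym e) tt)))
... | false | true  = ≤-trans (count-mono _ _ (h ∘ suc)) (n≤1+n _)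
... | false | false = count-mono _ _ (h ∘ suc)

count-disjoint : ∀ {k} (p p′ : Fin k → Bool) → (∀ i → T (p i) → T (p′ i) → ⊥) →
                 count p + count p′ ≤ k
count-disjoint {zero}  p p′ d = z≤n
count-disjoint {suc k} p p′ d with p zero in e | p′ zero in e′
... | true  | true  = ⊥-elim (d zero (subst T (sym e) tt) (subst T (sym e′) tt))
... | true  | false = s≤s (count-disjoint _ _ (d ∘ suc))
... | false | true  = subst (_≤ suc k) (sym (+-suc _ _)) (s≤s (count-disjoint _ _ (d ∘ suc)))
... | false | false = ≤-trans (count-disjoint _ _ (d ∘ suc)) (n≤1+n k)

majorities-meet : ∀ {k} (p p′ : Fin k → Bool) → k < 2 * count p → k < 2 * count p′ →
                  ∃ λ i → T (p i) × T (p′ i)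
majorities-meet {k} p p′ maj maj′ with any? (λ i → T? (p i) ×-dec T? (p′ i))
... | yes common = common
... | no none = ⊥-elim (<-irrefl refl (*-cancelˡ-≤ 2 too-many))
  where
    open ≤-Reasoning
    too-many : 2 * suc k ≤ 2 * k
    too-many = begin
      2 * suc k                   ≡⟨ cong (suc k +_) (+-identityʳ (suc k)) ⟩
      suc k + suc k               ≤⟨ +-mono-≤ maj maj′ ⟩
      2 * count p + 2 * count p′  ≡⟨ sym (*-distribˡ-+ 2 (count p) (count p′)) ⟩
      2 * (count p + count p′)    ≤⟨ *-monoʳ-≤ 2 (count-disjoint p p′ (λ i pi p′i → none (i , pi , p′i))) ⟩
      2 * k                       ∎

majority-mono : ∀ {n k} {prof prof′ : Fin k → Ord n} {x y} →
                (∀ i → rel (prof i) x y → rel (prof′ i) x y) → Majority prof x y → Majority prof′ x y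
majority-mono h maj = ≤-trans maj (*-monoʳ-≤ 2 (count-mono _ _ h))

module _ {A : Set} where

  tc-map : ∀ {_∼_ _≈_ : A → A → Set} → (∀ {x y} → x ∼ y → x ≈ y) →
           ∀ {x y} → TransClosure _∼_ x y → TransClosure _≈_ x y
  tc-map h [ a ]   = [ h a ]
  tc-map h (a ∷ t) = h a ∷ tc-map h t

  tc-split : ∀ {_∼_ : A → A → Set} (B : A → A → Set) → (∀ x y → Dec (B x y)) →
             ∀ {x y} → TransClosure _∼_ x y →
             (∃ λ a → ∃ λ b → a ∼ b × B a b) ⊎ TransClosure (λ a b → a ∼ b × ¬ B a b) x y
  tc-split B B? {x} {y} [ a ] with B? x y
  ... | yes b  = inj₁ (x , y , a , b)
  ... | no ¬b  = inj₂ [ a , ¬b ]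
  tc-split B B? {x} (_∷_ {y = y} a t) with B? x y | tc-split B B? t
  ... | yes b | _        = inj₁ (x , y , a , b)
  ... | no _  | inj₁ hit = inj₁ hit
  ... | no ¬b | inj₂ t′  = inj₂ ((a , ¬b) ∷ t′)

-- The extension D ∪ {P}

module Extension
  {n : ℕ} (D : Domain n) (isD : IsDomain D)
  {m : ℕ} {G : Graph m} (tree : IsTree G) (f : Fin m → Ord n)
  (f-D : ∀ v → D (f v)) (f-inj : Injective _≡_ _≡_ f) (f-onto : ∀ S → D S → ∃ λ v → f v ≡ S)
  (crossing : ∀ u v w → OnPath G u v w → f u ∈[ f v , f w ])
  {q r : Fin m} {P : Ord n} (adj : AdjΓ D (f q) (f r)) (P∈ : P ∈[ f q , f r ])
  (P≢Q : P ≢ f q) (P≢R : P ≢ f r) where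

  open IsTree tree
  open Walks G using (walk-head; walk-last; toPath)

  Q R : Ord n
  Q = f q
  R = f r

  lin : ∀ v → IsLinOrder (f v)
  lin v = isD (f v) (f-D v)

  linP : IsLinOrder P
  linP = proj₁ P∈

  D-Q : D Q
  D-Q = proj₁ adj

  D-R : D R
  D-R = proj₁ (proj₂ adj)

  Q≢R : Q ≢ R
  Q≢R = proj₁ (proj₂ (proj₂ adj))

  only-ends : ∀ S → D S → S ∈[ Q , R ] → S ≡ Q ⊎ S ≡ R
  only-ends = proj₂ (proj₂ (proj₂ adj))

  P∉D : ¬ D P
  P∉D D-P = [ P≢Q , P≢R ]′ (only-ends P D-P P∈)

  -- q and r are adjacent in the tree: the vertex after q on the path to r
  -- carries an order of D in [Q , R], so it is r
  q–r : T (G q r)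
  q–r with toPath (proj₂ (connected q r))
  ... | _ , here _ , _ = ⊥-elim (Q≢R refl)
  ... | ps , step {v = v} e w , uq
    with only-ends (f v) (f-D v) (crossing v q r (ps , (step e w , uq) , there (walk-head w)))
  ...   | inj₁ fv≡Q = ⊥-elim (irreflexive q (subst (λ z → T (G q z)) (f-inj fv≡Q) e))
  ...   | inj₂ fv≡R = subst (λ z → T (G q z)) (f-inj fv≡R) e

  D⁺ : Domain n
  D⁺ = D ∪｛ P ｝

  D⁺-domain : IsDomain D⁺
  D⁺-domain S (inj₁ D-S)  = isD S D-S
  D⁺-domain S (inj₂ refl) = linP

  -- Voters f a, f b agreeing with P on a pair where P departs from Q, resp.
  -- from R, agree only where P does: the path from a to r avoids q and the
  -- path from q to b avoids r, so joined through r–q they form a path from a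
  -- to b through q and r, whence Q, R ∈ [f a , f b] and P ∈ [f a , f b].
  common-in-P : ∀ a b {x₁ y₁ x₂ y₂} →
    rel (f a) x₁ y₁ → rel P x₁ y₁ → rel Q y₁ x₁ →
    rel (f b) x₂ y₂ → rel P x₂ y₂ → rel R y₂ x₂ →
    ∀ {x y} → rel (f a) x y → rel (f b) x y → rel P x y
  common-in-P a b a₁ p₁ q₁ b₂ p₂ r₂ {x} {y} axy bxy
    with toPath (proj₂ (connected a r)) | toPath (proj₂ (connected q b))
  ... | ps , a⇝r | qs , q⇝b = proj₂ (interval-trans {P = P} {Q} {R} {f a} {f b} P∈ (crossing q a b on-q) (crossing r a b on-r)) x y axy bxy
    where
      q∉ : q ∉ ps
      q∉ q∈ = asym (lin q) (proj₂ (crossing q a r (ps , a⇝r , q∈)) _ _ a₁ (interval-flip {P = P} {A = Q} {B = R} (lin r) P∈ p₁ q₁)) q₁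
      r∉ : r ∉ qs
      r∉ r∈ = asym (lin r) (proj₂ (crossing r q b (qs , q⇝b , r∈)) _ _
                 (interval-flip {P = P} {A = R} {B = Q} (lin q) (interval-sym {O = P} {A = Q} {B = R} P∈) p₂ r₂) b₂) r₂
      a⇝b : IsPath G a b (ps ++ qs)
      a⇝b = TreeEdge.join-through-edge tree (symmetric q r q–r) a⇝r q∉ q⇝b r∉
      on-q : OnPath G q a b
      on-q = ps ++ qs , a⇝b , ∈-++⁺ʳ ps (walk-head (proj₁ q⇝b))
      on-r : OnPath G r a b
      on-r = ps ++ qs , a⇝b , ∈-++⁺ˡ (walk-last (proj₁ a⇝r))

  module Profile (D-condorcet : IsCondorcet D) {k : ℕ} (prof : Fin k → Ord n)
                 (prof-D⁺ : ∀ i → D⁺ (prof i)) where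

    _≻_ : Fin n → Fin n → Set
    _≻_ = Majority prof

    switch : Ord n → Fin k → Ord n
    switch O i = [ const (prof i) , const O ]′ (prof-D⁺ i)

    switch-D : ∀ {O} → D O → ∀ i → D (switch O i)
    switch-D D-O i with prof-D⁺ i
    ... | inj₁ D-i = D-i
    ... | inj₂ _   = D-O

    switch-keeps : ∀ {O x y} → (rel P x y → rel O x y) → x ≻ y → Majority (switch O) x y
    switch-keeps {O} {x} {y} agree = majority-mono {prof = prof} {prof′ = switch O} kept
      where
        kept : ∀ i → rel (prof i) x y → rel (switch O i) x y
        kept i with prof-D⁺ i
        ... | inj₁ _    = id
        ... | inj₂ i≡P = agree ∘ rel-≡ i≡P

    QFlip RFlip : Fin n → Fin n → Set
    QFlip x y = rel P x y × rel Q y x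
    RFlip x y = rel P x y × rel R y x

    QFlip? : ∀ x y → Dec (QFlip x y)
    QFlip? x y = T? _ ×-dec T? _

    RFlip? : ∀ x y → Dec (RFlip x y)
    RFlip? x y = T? _ ×-dec T? _

    voter : ∀ i → prof i ≡ P ⊎ ∃ λ a → f a ≡ prof i
    voter i with prof-D⁺ i
    ... | inj₂ i≡P = inj₁ i≡P
    ... | inj₁ D-i = inj₂ (f-onto _ D-i)

    -- once some majority edge is a Q-flip and some is an R-flip, every
    -- majority edge lies in P: it shares a voter with each of the two
    majority-in-P : ∀ {x₁ y₁ x₂ y₂} → x₁ ≻ y₁ → QFlip x₁ y₁ → x₂ ≻ y₂ → RFlip x₂ y₂ →
                    ∀ {x y} → x ≻ y → rel P x y
    majority-in-P m₁ (p₁ , q₁) m₂ (p₂ , r₂) m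
      with majorities-meet _ _ m m₁ | majorities-meet _ _ m m₂
    ... | i , i-xy , i-x₁y₁ | j , j-xy , j-x₂y₂ with voter i | voter j
    ... | inj₁ i≡P | _        = rel-≡ i≡P i-xy
    ... | inj₂ _   | inj₁ j≡P = rel-≡ j≡P j-xy
    ... | inj₂ (a , fa≡i) | inj₂ (b , fb≡j) =
      common-in-P a b (rel-≡ (sym fa≡i) i-x₁y₁) p₁ q₁ (rel-≡ (sym fb≡j) j-x₂y₂) p₂ r₂
                      (rel-≡ (sym fa≡i) i-xy) (rel-≡ (sym fb≡j) j-xy)

    -- a majority cycle without Q-flips survives the switch of P-voters to
    -- Q, one without R-flips the switch to R; one with both lies in P
    majority-acyclic : Acyclic _≻_
    majority-acyclic x cycle with tc-split QFlip QFlip? cycle | tc-split RFlip RFlip? cycle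
    ... | inj₂ no-QFlip | _ =
      proj₂ D-condorcet k (switch Q) (switch-D D-Q) x (tc-map kept-by-Q no-QFlip)
      where
        kept-by-Q : ∀ {a b} → a ≻ b × ¬ QFlip a b → Majority (switch Q) a b
        kept-by-Q (ab , ¬flip) = switch-keeps (agree-unless-reversed linP (lin q) ¬flip) ab
    ... | inj₁ _ | inj₂ no-RFlip =
      proj₂ D-condorcet k (switch R) (switch-D D-R) x (tc-map kept-by-R no-RFlip)
      where
        kept-by-R : ∀ {a b} → a ≻ b × ¬ RFlip a b → Majority (switch R) a b
        kept-by-R (ab , ¬flip) = switch-keeps (agree-unless-reversed linP (lin r) ¬flip) ab
    ... | inj₁ (_ , _ , m₁ , flip₁) | inj₁ (_ , _ , m₂ , flip₂) =
      IsLinOrder.irrefl linP x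
        (transitive⁻ (rel P) (λ {a} {b} {c} → IsLinOrder.trans linP a b c)
          (tc-map (majority-in-P m₁ flip₁ m₂ flip₂) cycle))

  D⁺-condorcet : IsCondorcet D → IsCondorcet D⁺
  D⁺-condorcet D-condorcet =
    D⁺-domain , λ k prof prof-D⁺ → Profile.majority-acyclic D-condorcet prof prof-D⁺

  not-maximal : ¬ IsMaximalCondorcet D
  not-maximal (D-condorcet , maximal) =
    maximal D⁺ (D⁺-condorcet D-condorcet) (λ _ → inj₁) (P , inj₂ refl , P∉D)

  open Subdivision tree q–r
    using (G′; tree′; onPath-reverse; onPath-old; onPath-new-inner; onPath-new-start)
  open Walks G′ using (onPath-loop)

  f⁺ : Fin (suc m) → Ord n
  f⁺ zero    = P
  f⁺ (suc v) = f v

  f⁺-D : ∀ v → D⁺ (f⁺ v)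
  f⁺-D zero    = inj₂ refl
  f⁺-D (suc v) = inj₁ (f-D v)

  f⁺-inj : Injective _≡_ _≡_ f⁺
  f⁺-inj {zero}  {zero}  _     = refl
  f⁺-inj {zero}  {suc v} P≡fv  = ⊥-elim (P∉D (subst D (sym P≡fv) (f-D v)))
  f⁺-inj {suc u} {zero}  fu≡P  = ⊥-elim (P∉D (subst D fu≡P (f-D u)))
  f⁺-inj {suc u} {suc v} fu≡fv = cong suc (f-inj fu≡fv)

  f⁺-onto : ∀ S → D⁺ S → ∃ λ v → f⁺ v ≡ S
  f⁺-onto S (inj₁ D-S)  = suc (proj₁ (f-onto S D-S)) , proj₂ (f-onto S D-S)
  f⁺-onto S (inj₂ refl) = zero , refl

  -- paths starting at the new vertex pass through q and r
  crossing-from-new : ∀ u w → OnPath G′ (suc u) zero (suc w) → f u ∈[ P , f w ]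
  crossing-from-new u w on with onPath-new-start on
  ... | on-q , on-r =
    interval-merge {O = f u} {P} {Q} {R} {f w} (lin q) (lin r) P∈ (crossing u q w on-q) (crossing u r w on-r)

  f⁺-crossing : ∀ u v w → OnPath G′ u v w → f⁺ u ∈[ f⁺ v , f⁺ w ]
  f⁺-crossing zero    zero    _       _  = linP , λ _ _ pxy _ → pxy
  f⁺-crossing zero    (suc v) zero    _  = linP , λ _ _ _ pxy → pxy
  f⁺-crossing zero    (suc v) (suc w) on with onPath-new-inner on
  ... | on-q , on-r = interval-trans {P = P} {Q} {R} {f v} {f w} P∈ (crossing q v w on-q) (crossing r v w on-r)
  f⁺-crossing (suc u) zero    zero    on with onPath-loop on
  ... | ()
  f⁺-crossing (suc u) zero    (suc w) on = crossing-from-new u w on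
  f⁺-crossing (suc u) (suc v) zero    on =
    interval-sym {O = f u} {A = P} {B = f v} (crossing-from-new u v (onPath-reverse on))
  f⁺-crossing (suc u) (suc v) (suc w) on = crossing u v w (onPath-old on)

  single-crossing : GeneralizedSingleCrossing D⁺
  single-crossing = suc m , G′ , tree′ , f⁺ , f⁺-D , f⁺-inj , f⁺-onto , f⁺-crossing

lemma5p1 : ∀ (n : ℕ) (D : Domain n) → IsDomain D → GeneralizedSingleCrossing D →
    ∀ (Q R P : Ord n) → AdjΓ D Q R → P ∈[ Q , R ] → P ≢ Q → P ≢ R →
    GeneralizedSingleCrossing (D ∪｛ P ｝) × ¬ IsMaximalCondorcet D
lemma5p1 n D isD (m , G , tree , f , f-D , f-inj , f-onto , crossing) Q R P adj P∈ P≢Q P≢R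
  with f-onto Q (proj₁ adj) | f-onto R (proj₁ (proj₂ adj))
... | q , refl | r , refl = single-crossing , not-maximal
  where open Extension D isD tree f f-D f-inj f-onto crossing adj P∈ P≢Q P≢R
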